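{- Let $\mathcal{M}$ be the set of Motzkin meanders that contain neither $DD$ nor $DU$ as a contiguous subword, and let $S(u)=\sum_{w\in\mathcal{M}} z^{|w|}u^{\mathrm{level}(w)}$. Put $$W=\sqrt{1-2z+z^2-4z^3},\qquad r_1=\frac{1-z-W}{2z}.$$ Then $$S(u)=\frac{r_1(1+r_1)}{z(z-ur_1)},$$ and for every $j\ge0$ the generating function of the meanders in $\mathcal{M}$ ending at level $j$ is $[u^j]S(u)=\frac{1+r_1}{z}\Big(\frac{r_1}{z}\Big)^{j+1}$.
   Context: A Motzkin meander is a finite word $w$ over $\{U,H,D\}$ (heights $+1,0,-1$) all of whose prefixes have nonnegative height sum; $|w|$ is its length and $\mathrm{level}(w)$ its total height sum; the empty word is included; excursions are meanders of level $0$. "Contains $XY$ as a contiguous subword" means two consecutive letters are $X$ then $Y$. Generating functions are formal power series in $z$; $W$ is the formal power series square root with constant term $1$; $[u^j]$ is coefficient extraction. -}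

module Defs where

open import Data.Bool using (Bool; true; false; _∧_; not)
open import Data.Nat using (ℕ; zero; suc) renaming (_≡ᵇ_ to _≡ᵇℕ_)
open import Data.Integer as ℤ using (ℤ; +_; -[1+_]; _≤ᵇ_)
open import Data.List using (List; []; _∷_; length; filterᵇ; map; concatMap; inits; upTo)
open import Data.Rational as ℚ using (ℚ; 0ℚ; 1ℚ)
open import Relation.Binary.PropositionalEquality using (_≡_)
open import Relation.Nullary.Decidable using (does)

data Step : Set where
  U H D : Step

stepHeight : Step → ℤ
stepHeight U = + 1
stepHeight H = + 0
stepHeight D = -[1+ 0 ]

level : List Step → ℤ
level []      = + 0
level (s ∷ w) = stepHeight s ℤ.+ level w

allB : {A : Set} → (A → Bool) → List A → Bool
allB p []       = true
allB p (x ∷ xs) = p x ∧ allB p xs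

isMeander : List Step → Bool
isMeander w = allB (λ p → + 0 ≤ᵇ level p) (inits w)

isD : Step → Bool
isD D = true
isD _ = false

isU : Step → Bool
isU U = true
isU _ = false

containsDD : List Step → Bool
containsDD []           = false
containsDD (_ ∷ [])     = false
containsDD (x ∷ y ∷ w)  = (isD x ∧ isD y) Data.Bool.∨ containsDD (y ∷ w)

containsDU : List Step → Bool
containsDU []           = false
containsDU (_ ∷ [])     = false
containsDU (x ∷ y ∷ w)  = (isD x ∧ isU y) Data.Bool.∨ containsDU (y ∷ w)

inM : List Step → Bool
inM w = isMeander w ∧ not (containsDD w) ∧ not (containsDU w)

allWords : ℕ → List (List Step)
allWords zero    = [] ∷ []
allWords (suc n) = concatMap (λ w → (U ∷ w) ∷ (H ∷ w) ∷ (D ∷ w) ∷ []) (allWords n)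

countM : ℕ → ℕ → ℕ
countM n j = length (filterᵇ (λ w → inM w ∧ does (level w ℤ.≟ + j)) (allWords n))

Series : Set
Series = ℕ → ℚ

_≈_ : Series → Series → Set
f ≈ g = ∀ n → f n ≡ g n
infix 4 _≈_

ℕtoℚ : ℕ → ℚ
ℕtoℚ n = (+ n) ℚ./ 1

const : ℚ → Series
const c zero    = c
const c (suc n) = 0ℚ

𝟘 𝟙 : Series
𝟘 = const 0ℚ
𝟙 = const 1ℚ

zS : Series
zS zero          = 0ℚ
zS (suc zero)    = 1ℚ
zS (suc (suc n)) = 0ℚ

_⊕_ : Series → Series → Series
(f ⊕ g) n = f n ℚ.+ g n

_⊖_ : Series → Series → Series
(f ⊖ g) n = f n ℚ.- g n

scale : ℚ → Series → Series
scale c f n = c ℚ.* f n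

sumℚ : List ℚ → ℚ
sumℚ []       = 0ℚ
sumℚ (x ∷ xs) = x ℚ.+ sumℚ xs

_⊛_ : Series → Series → Series
(f ⊛ g) n = sumℚ (map (λ i → f i ℚ.* g (n Data.Nat.∸ i)) (upTo (suc n)))

infixl 6 _⊕_ _⊖_
infixl 7 _⊛_

_^^_ : Series → ℕ → Series
f ^^ zero  = 𝟙
f ^^ suc k = f ⊛ (f ^^ k)

Wsq : Series
Wsq = 𝟙 ⊖ scale (ℕtoℚ 2) zS ⊕ (zS ^^ 2) ⊖ scale (ℕtoℚ 4) (zS ^^ 3)

-- generating function Σ_n |{w ∈ 𝓜 : |w| = n, level w = j}| z^n  (= [u^j] S(u))
Fj : ℕ → Series
Fj j n = ℕtoℚ (countM n j)

-- Bivariate series in z,u as ℚ[[z]][[u]]: coefficient of u^j is a series in z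

BSeries : Set
BSeries = ℕ → Series

_≈₂_ : BSeries → BSeries → Set
F ≈₂ G = ∀ j → F j ≈ G j
infix 4 _≈₂_

embed : Series → BSeries
embed f zero    = f
embed f (suc j) = 𝟘

uB : BSeries
uB zero          = 𝟘
uB (suc zero)    = 𝟙
uB (suc (suc j)) = 𝟘

sumS : List Series → Series
sumS []       = 𝟘
sumS (f ∷ fs) = f ⊕ sumS fs

_⊕₂_ : BSeries → BSeries → BSeries
(F ⊕₂ G) j = F j ⊕ G j

_⊖₂_ : BSeries → BSeries → BSeries
(F ⊖₂ G) j = F j ⊖ G j

_⊛₂_ : BSeries → BSeries → BSeries
(F ⊛₂ G) j = sumS (map (λ i → F i ⊛ G (j Data.Nat.∸ i)) (upTo (suc j)))

infixl 6 _⊕₂_ _⊖₂_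
infixl 7 _⊛₂_

S : BSeries
S = Fj

{-# OPTIONS --safe #-}
module Submission where

-- Read letter by letter, a word stays in 𝓜 as long as its level stays nonnegative and no D
-- is followed by D or U, so it suffices to remember its level h and whether it ends in D.
-- Let A_h, B_h be the generating functions of the meanders of 𝓜 at level h not ending, resp.
-- ending, in D. Appending a letter gives
--   A₀ = 1 + zA₀ + zB₀,   A_{h+1} = zA_h + zA_{h+1} + zB_{h+1},   B_h = zA_{h+1}.
-- Thus X_h = z^{h+2} A_h solves X₀ = z(z + X₀ + X₁), X_{h+1} = z(zX_h + X_{h+1} + X_{h+2}).
-- Each coefficient of a solution is determined by earlier ones, so the solution is unique, and
-- X_h = r^{h+1} is one as soon as r = z(z + r + r²). The kernel root r₁ is such an r, since
-- W = 1 − z − 2z r₁ squares to 1 − 2z + z² − 4z³ exactly when r₁ = z(z + r₁ + r₁²).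
-- Hence z^{j+2} [u^j]S = X_j + X_{j+1} = (1 + r₁) r₁^{j+1}, which also gives
-- z(z − u r₁) S(u) = r₁(1 + r₁) coefficientwise. The same causality argument produces the
-- fixed point of r ↦ z(z + r + r²), hence the square root W.

open import Algebra.Bundles using (CommutativeRing)
import Algebra.Construct.Pointwise as Pointwise
import Algebra.Properties.CommutativeSemigroup as CommutativeSemigroupProperties
import Algebra.Properties.Group as GroupProperties
import Algebra.Solver.Ring as RingSolver
open import Algebra.Solver.Ring.AlmostCommutativeRing using (fromCommutativeRing; _-Raw-AlmostCommutative⟶_)
open import Data.Bool using (Bool; true; false; _∧_; _∨_; not; if_then_else_)
import Data.Bool.Properties as Bool
open import Data.Integer as ℤ using (ℤ; +_; _≤ᵇ_)
import Data.Integer.Properties as ℤ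
open import Data.List using (List; []; _∷_; _++_; _∷ʳ_; map; length; filterᵇ; concatMap; inits; upTo)
import Data.List.Properties as List
open import Data.Maybe using (Maybe; just; nothing)
open import Data.Nat as ℕ using (ℕ; zero; suc; _∸_; _<_; _≤_; _≤′_; ≤′-reflexive; ≤′-step; z≤n; s≤s)
import Data.Nat.Coprimality as Coprimality
open import Data.Nat.ListAction using (sum)
import Data.Nat.ListAction.Properties as ℕ
import Data.Nat.Properties as ℕ
open import Data.Product using (Σ; _×_; _,_)
open import Data.Rational as ℚ using (ℚ; 0ℚ; 1ℚ)
import Data.Rational.Properties as ℚ
open import Data.Sum using (inj₁; inj₂)
open import Data.Unit using (⊤; tt)
open import Function using (_∘_)
open import Level using (_⊔_; 0ℓ)
open import Relation.Binary.Bundles using (Setoid)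
import Relation.Binary.PropositionalEquality as ≡
open ≡ using (_≡_)
import Relation.Binary.Reasoning.Setoid as SetoidReasoning
open import Relation.Nullary.Decidable using (does; yes; no)

-- Formal power series over a commutative ring

-- The Cauchy product is parametrised by the list sum so that it is definitionally Defs._⊛_
-- for sumℚ and Defs._⊛₂_ for sumS.
record ListSum {c ℓ} (R : CommutativeRing c ℓ) : Set (c ⊔ ℓ) where
  open CommutativeRing R
  field
    ∑    : List Carrier → Carrier
    ∑-[] : ∑ [] ≈ 0#
    ∑-∷  : ∀ x xs → ∑ (x ∷ xs) ≈ x + ∑ xs

module CauchyProduct {c ℓ} (R : CommutativeRing c ℓ) (listSum : ListSum R) where

  open CommutativeRing R
  open ListSum listSum

  open SetoidReasoning setoid
  open CommutativeSemigroupProperties +-commutativeSemigroup using (interchange; x∙yz≈y∙xz)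

  PowerSeries : Set c
  PowerSeries = ℕ → Carrier

  infix 4 _≋_
  infixl 6 _⊞_
  infixl 7 _·_ _⋆_

  _≋_ : PowerSeries → PowerSeries → Set ℓ
  f ≋ g = ∀ n → f n ≈ g n

  _⊞_ : PowerSeries → PowerSeries → PowerSeries
  (f ⊞ g) n = f n + g n

  ⊟_ : PowerSeries → PowerSeries
  (⊟ f) n = - f n

  _⋆_ : Carrier → PowerSeries → PowerSeries
  (a ⋆ f) n = a * f n

  _·_ : PowerSeries → PowerSeries → PowerSeries
  (f · g) n = ∑ (map (λ i → f i * g (n ∸ i)) (upTo (suc n)))

  shift : PowerSeries → PowerSeries
  shift f n = f (suc n)

  𝟎 : PowerSeries
  𝟎 _ = 0#

  ι : Carrier → PowerSeries
  ι a zero    = a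
  ι a (suc n) = 0#

  X : PowerSeries
  X zero          = 0#
  X (suc zero)    = 1#
  X (suc (suc n)) = 0#

  ·-zero : ∀ f g → (f · g) 0 ≈ f 0 * g 0
  ·-zero f g = trans (∑-∷ _ []) (trans (+-congˡ ∑-[]) (+-identityʳ _))

  ·-suc : ∀ f g n → (f · g) (suc n) ≈ f 0 * g (suc n) + (shift f · g) n
  ·-suc f g n = trans (∑-∷ _ _) (+-congˡ (reflexive (≡.cong ∑ (≡.trans
    (List.map-applyUpTo suc (λ i → f i * g (suc n ∸ i)) (suc n))
    (≡.sym (List.map-upTo (λ i → f (suc i) * g (n ∸ i)) (suc n)))))))

  ·-local : ∀ n {f f′ g g′} → (∀ i → i ≤ n → f i ≈ f′ i) → (∀ i → i ≤ n → g i ≈ g′ i) →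
            (f · g) n ≈ (f′ · g′) n
  ·-local zero {f} {f′} {g} {g′} f≈ g≈ = begin
    (f · g) 0      ≈⟨ ·-zero f g ⟩
    f 0 * g 0      ≈⟨ *-cong (f≈ 0 z≤n) (g≈ 0 z≤n) ⟩
    f′ 0 * g′ 0    ≈⟨ ·-zero f′ g′ ⟨
    (f′ · g′) 0    ∎
  ·-local (suc n) {f} {f′} {g} {g′} f≈ g≈ = begin
    (f · g) (suc n)                            ≈⟨ ·-suc f g n ⟩
    f 0 * g (suc n) + (shift f · g) n          ≈⟨ +-cong (*-cong (f≈ 0 z≤n) (g≈ (suc n) ℕ.≤-refl))
                                                    (·-local n (λ i i≤n → f≈ (suc i) (s≤s i≤n)) (λ i i≤n → g≈ i (ℕ.m≤n⇒m≤1+n i≤n))) ⟩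
    f′ 0 * g′ (suc n) + (shift f′ · g′) n      ≈⟨ ·-suc f′ g′ n ⟨
    (f′ · g′) (suc n)                          ∎

  ·-cong : ∀ {f f′ g g′} → f ≋ f′ → g ≋ g′ → f · g ≋ f′ · g′
  ·-cong f≈ g≈ n = ·-local n (λ i _ → f≈ i) (λ i _ → g≈ i)

  ·-zeroˡ : ∀ g → 𝟎 · g ≋ 𝟎
  ·-zeroˡ g zero    = trans (·-zero 𝟎 g) (zeroˡ (g 0))
  ·-zeroˡ g (suc n) = begin
    (𝟎 · g) (suc n)               ≈⟨ ·-suc 𝟎 g n ⟩
    0# * g (suc n) + (𝟎 · g) n    ≈⟨ +-cong (zeroˡ (g (suc n))) (·-zeroˡ g n) ⟩
    0# + 0#                       ≈⟨ +-identityʳ 0# ⟩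
    0#                            ∎

  ι-· : ∀ a g → ι a · g ≋ a ⋆ g
  ι-· a g zero    = ·-zero (ι a) g
  ι-· a g (suc n) = begin
    (ι a · g) (suc n)                 ≈⟨ ·-suc (ι a) g n ⟩
    a * g (suc n) + (𝟎 · g) n         ≈⟨ +-congˡ (·-zeroˡ g n) ⟩
    a * g (suc n) + 0#                ≈⟨ +-identityʳ _ ⟩
    a * g (suc n)                     ∎

  ·-identityˡ : ∀ g → ι 1# · g ≋ g
  ·-identityˡ g n = trans (ι-· 1# g n) (*-identityˡ (g n))

  ·-distribʳ : ∀ f g h → (f ⊞ g) · h ≋ f · h ⊞ g · h
  ·-distribʳ f g h zero = begin
    ((f ⊞ g) · h) 0              ≈⟨ ·-zero (f ⊞ g) h ⟩
    (f 0 + g 0) * h 0            ≈⟨ distribʳ (h 0) (f 0) (g 0) ⟩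
    f 0 * h 0 + g 0 * h 0        ≈⟨ +-cong (·-zero f h) (·-zero g h) ⟨
    (f · h) 0 + (g · h) 0        ∎
  ·-distribʳ f g h (suc n) = begin
    ((f ⊞ g) · h) (suc n)                                              ≈⟨ ·-suc (f ⊞ g) h n ⟩
    (f 0 + g 0) * h (suc n) + ((shift f ⊞ shift g) · h) n              ≈⟨ +-congˡ (·-distribʳ (shift f) (shift g) h n) ⟩
    (f 0 + g 0) * h (suc n) + ((shift f · h) n + (shift g · h) n)      ≈⟨ +-congʳ (distribʳ (h (suc n)) (f 0) (g 0)) ⟩
    (f 0 * h (suc n) + g 0 * h (suc n)) + ((shift f · h) n + (shift g · h) n)
                                                                       ≈⟨ interchange _ _ _ _ ⟩
    (f 0 * h (suc n) + (shift f · h) n) + (g 0 * h (suc n) + (shift g · h) n)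
                                                                       ≈⟨ +-cong (·-suc f h n) (·-suc g h n) ⟨
    (f · h) (suc n) + (g · h) (suc n)                                  ∎

  ·-scaleˡ : ∀ a f g → (a ⋆ f) · g ≋ a ⋆ (f · g)
  ·-scaleˡ a f g zero = begin
    ((a ⋆ f) · g) 0      ≈⟨ ·-zero (a ⋆ f) g ⟩
    a * f 0 * g 0        ≈⟨ *-assoc a (f 0) (g 0) ⟩
    a * (f 0 * g 0)      ≈⟨ *-congˡ (·-zero f g) ⟨
    a * (f · g) 0        ∎
  ·-scaleˡ a f g (suc n) = begin
    ((a ⋆ f) · g) (suc n)                           ≈⟨ ·-suc (a ⋆ f) g n ⟩
    a * f 0 * g (suc n) + ((a ⋆ shift f) · g) n     ≈⟨ +-congˡ (·-scaleˡ a (shift f) g n) ⟩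
    a * f 0 * g (suc n) + a * (shift f · g) n       ≈⟨ +-congʳ (*-assoc a (f 0) (g (suc n))) ⟩
    a * (f 0 * g (suc n)) + a * (shift f · g) n     ≈⟨ distribˡ a _ _ ⟨
    a * (f 0 * g (suc n) + (shift f · g) n)         ≈⟨ *-congˡ (·-suc f g n) ⟨
    a * (f · g) (suc n)                             ∎

  ·-sucʳ : ∀ f g n → (f · g) (suc n) ≈ f (suc n) * g 0 + (f · shift g) n
  ·-sucʳ f g zero = begin
    (f · g) 1                        ≈⟨ ·-suc f g 0 ⟩
    f 0 * g 1 + (shift f · g) 0      ≈⟨ +-congˡ (·-zero (shift f) g) ⟩
    f 0 * g 1 + f 1 * g 0            ≈⟨ +-comm _ _ ⟩
    f 1 * g 0 + f 0 * g 1            ≈⟨ +-congˡ (·-zero f (shift g)) ⟨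
    f 1 * g 0 + (f · shift g) 0      ∎
  ·-sucʳ f g (suc n) = begin
    (f · g) (suc (suc n))                                                    ≈⟨ ·-suc f g (suc n) ⟩
    f 0 * g (suc (suc n)) + (shift f · g) (suc n)                            ≈⟨ +-congˡ (·-sucʳ (shift f) g n) ⟩
    f 0 * g (suc (suc n)) + (f (suc (suc n)) * g 0 + (shift f · shift g) n)  ≈⟨ x∙yz≈y∙xz _ _ _ ⟩
    f (suc (suc n)) * g 0 + (f 0 * g (suc (suc n)) + (shift f · shift g) n)  ≈⟨ +-congˡ (·-suc f (shift g) n) ⟨
    f (suc (suc n)) * g 0 + (f · shift g) (suc n)                            ∎

  ·-comm : ∀ f g → f · g ≋ g · f
  ·-comm f g zero    = trans (·-zero f g) (trans (*-comm (f 0) (g 0)) (sym (·-zero g f)))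
  ·-comm f g (suc n) = begin
    (f · g) (suc n)                         ≈⟨ ·-suc f g n ⟩
    f 0 * g (suc n) + (shift f · g) n       ≈⟨ +-cong (*-comm (f 0) (g (suc n))) (·-comm (shift f) g n) ⟩
    g (suc n) * f 0 + (g · shift f) n       ≈⟨ ·-sucʳ g f n ⟨
    (g · f) (suc n)                         ∎

  ·-assoc : ∀ f g h → (f · g) · h ≋ f · (g · h)
  ·-assoc f g h zero = begin
    ((f · g) · h) 0           ≈⟨ ·-zero (f · g) h ⟩
    (f · g) 0 * h 0           ≈⟨ *-congʳ (·-zero f g) ⟩
    f 0 * g 0 * h 0           ≈⟨ *-assoc (f 0) (g 0) (h 0) ⟩
    f 0 * (g 0 * h 0)         ≈⟨ *-congˡ (·-zero g h) ⟨
    f 0 * (g · h) 0           ≈⟨ ·-zero f (g · h) ⟨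
    (f · (g · h)) 0           ∎
  ·-assoc f g h (suc n) = begin
    ((f · g) · h) (suc n)                                                       ≈⟨ ·-suc (f · g) h n ⟩
    (f · g) 0 * h (suc n) + (shift (f · g) · h) n                               ≈⟨ +-cong (*-congʳ (·-zero f g)) (·-cong {g = h} (·-suc f g) (λ _ → refl) n) ⟩
    f 0 * g 0 * h (suc n) + ((f 0 ⋆ shift g ⊞ shift f · g) · h) n               ≈⟨ +-congˡ (·-distribʳ (f 0 ⋆ shift g) (shift f · g) h n) ⟩
    f 0 * g 0 * h (suc n) + (((f 0 ⋆ shift g) · h) n + ((shift f · g) · h) n)  ≈⟨ +-congˡ (+-cong (·-scaleˡ (f 0) (shift g) h n) (·-assoc (shift f) g h n)) ⟩
    f 0 * g 0 * h (suc n) + (f 0 * (shift g · h) n + (shift f · (g · h)) n)     ≈⟨ +-assoc _ _ _ ⟨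
    (f 0 * g 0 * h (suc n) + f 0 * (shift g · h) n) + (shift f · (g · h)) n     ≈⟨ +-congʳ (+-congʳ (*-assoc (f 0) (g 0) (h (suc n)))) ⟩
    (f 0 * (g 0 * h (suc n)) + f 0 * (shift g · h) n) + (shift f · (g · h)) n   ≈⟨ +-congʳ (distribˡ (f 0) _ _) ⟨
    f 0 * (g 0 * h (suc n) + (shift g · h) n) + (shift f · (g · h)) n           ≈⟨ +-congʳ (*-congˡ (·-suc g h n)) ⟨
    f 0 * (g · h) (suc n) + (shift f · (g · h)) n                               ≈⟨ ·-suc f (g · h) n ⟨
    (f · (g · h)) (suc n)                                                       ∎

  commutativeRing : CommutativeRing c ℓ
  commutativeRing = record
    { Carrier = PowerSeries ; _≈_ = _≋_ ; _+_ = _⊞_ ; _*_ = _·_ ; -_ = ⊟_ ; 0# = 𝟎 ; 1# = ι 1#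
    ; isCommutativeRing = record
      { isRing = record
        { +-isAbelianGroup = Pointwise.isAbelianGroup ℕ +-isAbelianGroup
        ; *-cong = ·-cong
        ; *-assoc = ·-assoc
        ; *-identity = ·-identityˡ , λ f n → trans (·-comm f (ι 1#) n) (·-identityˡ f n)
        ; distrib = (λ f g h n → trans (·-comm f (g ⊞ h) n) (trans (·-distribʳ g h f n) (+-cong (·-comm g f n) (·-comm h f n))))
                  , (λ h f g → ·-distribʳ f g h)
        }
      ; *-comm = ·-comm
      }
    }

  X-·-zero : ∀ f → (X · f) 0 ≈ 0#
  X-·-zero f = trans (·-zero X f) (zeroˡ (f 0))

  X-·-suc : ∀ f n → (X · f) (suc n) ≈ f n
  X-·-suc f n = begin
    (X · f) (suc n)                    ≈⟨ ·-suc X f n ⟩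
    0# * f (suc n) + (shift X · f) n   ≈⟨ +-cong (zeroˡ (f (suc n))) (·-cong {g = f} shift-X≋1 (λ _ → refl) n) ⟩
    0# + (ι 1# · f) n                  ≈⟨ +-identityˡ _ ⟩
    (ι 1# · f) n                       ≈⟨ ·-identityˡ f n ⟩
    f n                                ∎
    where
    shift-X≋1 : shift X ≋ ι 1#
    shift-X≋1 zero    = refl
    shift-X≋1 (suc n) = refl

  X-·-causal : ∀ n {f g} → (∀ m → m < n → f m ≈ g m) → (X · f) n ≈ (X · g) n
  X-·-causal zero    {f} {g} _   = trans (X-·-zero f) (sym (X-·-zero g))
  X-·-causal (suc n) {f} {g} f≈g = trans (X-·-suc f n) (trans (f≈g n ℕ.≤-refl) (sym (X-·-suc g n)))

-- Fixed points of causal maps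

module CausalFixedPoint {a ℓ} (S : Setoid a ℓ) (I : Set) where

  open Setoid S

  Family : Set a
  Family = I → ℕ → Carrier

  AgreeBelow : ℕ → Family → Family → Set ℓ
  AgreeBelow n x y = ∀ i m → m < n → x i m ≈ y i m

  Causal : (Family → Family) → Set (a ⊔ ℓ)
  Causal F = ∀ n {x y} → AgreeBelow n x y → ∀ i → F x i n ≈ F y i n

  AgreeBelow-mono : ∀ {m n x y} → m ≤ n → AgreeBelow n x y → AgreeBelow m x y
  AgreeBelow-mono m≤n agree i k k<m = agree i k (ℕ.<-≤-trans k<m m≤n)

  IsFixedPoint : (Family → Family) → Family → Set ℓ
  IsFixedPoint F x = ∀ i n → x i n ≈ F x i n

  module _ {F : Family → Family} (causal : Causal F) where

    fixedPoint-unique : ∀ {x y} → IsFixedPoint F x → IsFixedPoint F y → ∀ i n → x i n ≈ y i n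
    fixedPoint-unique {x} {y} fx fy i n = agree (suc n) i n ℕ.≤-refl
      where
      agree : ∀ n → AgreeBelow n x y
      agree zero    i m ()
      agree (suc n) i m m<1+n with ℕ.m<1+n⇒m<n∨m≡n m<1+n
      ... | inj₁ m<n    = agree n i m m<n
      ... | inj₂ ≡.refl = trans (fx i m) (trans (causal m (agree m) i) (sym (fy i m)))

    iterate : Family → ℕ → Family
    iterate x₀ zero    = x₀
    iterate x₀ (suc t) = F (iterate x₀ t)

    iterate-step : ∀ x₀ t → AgreeBelow t (iterate x₀ t) (iterate x₀ (suc t))
    iterate-step x₀ zero    i m ()
    iterate-step x₀ (suc t) i m m<1+t = causal m (AgreeBelow-mono (ℕ.≤-pred m<1+t) (iterate-step x₀ t)) i

    iterate-settled : ∀ x₀ {t u} → t ≤′ u → AgreeBelow t (iterate x₀ t) (iterate x₀ u)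
    iterate-settled x₀ (≤′-reflexive ≡.refl) i m _   = refl
    iterate-settled x₀ (≤′-step {u} t≤u)      i m m<t =
      trans (iterate-settled x₀ t≤u i m m<t) (AgreeBelow-mono (ℕ.≤′⇒≤ t≤u) (iterate-step x₀ u) i m m<t)

    fixedPoint : Family → Family
    fixedPoint x₀ i n = iterate x₀ (suc n) i n

    fixedPoint-isFixedPoint : ∀ x₀ → IsFixedPoint F (fixedPoint x₀)
    fixedPoint-isFixedPoint x₀ i n = causal n settled i
      where
      settled : AgreeBelow n (iterate x₀ n) (fixedPoint x₀)
      settled i m m<n = sym (iterate-settled x₀ (ℕ.≤⇒≤′ m<n) i m ℕ.≤-refl)

-- Counting the meanders of 𝓜 with an automaton

open import Defs
open import Data.Nat using (_+_)
open ≡ using (refl; sym; trans; cong; cong₂; module ≡-Reasoning)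

sumWords : ℕ → (List Step → ℕ) → ℕ
sumWords zero    f = f []
sumWords (suc n) f = sumWords n (λ w → f (U ∷ w) + f (H ∷ w) + f (D ∷ w))

sumWords-cong : ∀ n {f g} → (∀ w → f w ≡ g w) → sumWords n f ≡ sumWords n g
sumWords-cong zero    f≡g = f≡g []
sumWords-cong (suc n) f≡g = sumWords-cong n λ w → cong₂ _+_ (cong₂ _+_ (f≡g (U ∷ w)) (f≡g (H ∷ w))) (f≡g (D ∷ w))

sumWords-+ : ∀ n f g → sumWords n (λ w → f w + g w) ≡ sumWords n f + sumWords n g
sumWords-+ zero    f g = refl
sumWords-+ (suc n) f g = trans (sumWords-cong n λ w → rearrange (f (U ∷ w)) (g (U ∷ w)) (f (H ∷ w)) (g (H ∷ w)) (f (D ∷ w)) (g (D ∷ w)))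
                               (sumWords-+ n _ _)
  where
  open import Data.Nat.Tactic.RingSolver using (solve-∀)
  rearrange : ∀ a b c d e f → (a + b) + (c + d) + (e + f) ≡ (a + c + e) + (b + d + f)
  rearrange = solve-∀

sumWords-∷ʳ : ∀ n f → sumWords (suc n) f ≡ sumWords n (f ∘ (_∷ʳ U)) + sumWords n (f ∘ (_∷ʳ H)) + sumWords n (f ∘ (_∷ʳ D))
sumWords-∷ʳ zero    f = refl
sumWords-∷ʳ (suc n) f = sumWords-∷ʳ n (λ w → f (U ∷ w) + f (H ∷ w) + f (D ∷ w))

sum-map-allWords : ∀ n f → sum (map f (allWords n)) ≡ sumWords n f
sum-map-allWords zero    f = ℕ.+-identityʳ (f [])
sum-map-allWords (suc n) f = begin
  sum (map f (concatMap extensions (allWords n)))   ≡⟨ sum-map-concatMap (allWords n) ⟩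
  sum (map (sum ∘ map f ∘ extensions) (allWords n)) ≡⟨ cong sum (List.map-cong sum-extensions (allWords n)) ⟩
  sum (map threeWay (allWords n))                   ≡⟨ sum-map-allWords n threeWay ⟩
  sumWords n threeWay                               ∎
  where
  open ≡-Reasoning
  extensions : List Step → List (List Step)
  extensions w = (U ∷ w) ∷ (H ∷ w) ∷ (D ∷ w) ∷ []
  threeWay : List Step → ℕ
  threeWay w = f (U ∷ w) + f (H ∷ w) + f (D ∷ w)
  sum-extensions : ∀ w → sum (map f (extensions w)) ≡ threeWay w
  sum-extensions w = trans (cong (λ t → f (U ∷ w) + (f (H ∷ w) + t)) (ℕ.+-identityʳ _)) (sym (ℕ.+-assoc (f (U ∷ w)) (f (H ∷ w)) (f (D ∷ w))))
  sum-map-concatMap : ∀ ws → sum (map f (concatMap extensions ws)) ≡ sum (map (sum ∘ map f ∘ extensions) ws)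
  sum-map-concatMap []       = refl
  sum-map-concatMap (w ∷ ws) = begin
    sum (map f (extensions w ++ concatMap extensions ws))                 ≡⟨ cong sum (List.map-++ f (extensions w) (concatMap extensions ws)) ⟩
    sum (map f (extensions w) ++ map f (concatMap extensions ws))         ≡⟨ ℕ.sum-++ (map f (extensions w)) (map f (concatMap extensions ws)) ⟩
    sum (map f (extensions w)) + sum (map f (concatMap extensions ws))    ≡⟨ cong₂ _+_ refl (sum-map-concatMap ws) ⟩
    sum (map f (extensions w)) + sum (map (sum ∘ map f ∘ extensions) ws)  ∎

indicator : Bool → ℕ
indicator true  = 1
indicator false = 0

length-filterᵇ : ∀ {A : Set} (p : A → Bool) xs → length (filterᵇ p xs) ≡ sum (map (indicator ∘ p) xs)
length-filterᵇ p []       = refl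
length-filterᵇ p (x ∷ xs) with p x
... | true  = cong suc (length-filterᵇ p xs)
... | false = length-filterᵇ p xs

endsWithD : List Step → Bool
endsWithD []          = false
endsWithD (x ∷ [])    = isD x
endsWithD (_ ∷ y ∷ w) = endsWithD (y ∷ w)

endsWithD-∷ʳ : ∀ w x → endsWithD (w ∷ʳ x) ≡ isD x
endsWithD-∷ʳ []          x = refl
endsWithD-∷ʳ (_ ∷ [])    x = refl
endsWithD-∷ʳ (_ ∷ y ∷ w) x = endsWithD-∷ʳ (y ∷ w) x

level-∷ʳ : ∀ w x → level (w ∷ʳ x) ≡ level w ℤ.+ stepHeight x
level-∷ʳ []      x = ℤ.+-comm (stepHeight x) (+ 0)
level-∷ʳ (y ∷ w) x = trans (cong (λ v → stepHeight y ℤ.+ v) (level-∷ʳ w x)) (sym (ℤ.+-assoc (stepHeight y) (level w) (stepHeight x)))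

containsDD-∷ʳ : ∀ w x → containsDD (w ∷ʳ x) ≡ containsDD w ∨ (endsWithD w ∧ isD x)
containsDD-∷ʳ []          x = refl
containsDD-∷ʳ (_ ∷ [])    x = Bool.∨-identityʳ _
containsDD-∷ʳ (y ∷ z ∷ w) x = trans (cong ((isD y ∧ isD z) ∨_) (containsDD-∷ʳ (z ∷ w) x)) (sym (Bool.∨-assoc (isD y ∧ isD z) _ _))

containsDU-∷ʳ : ∀ w x → containsDU (w ∷ʳ x) ≡ containsDU w ∨ (endsWithD w ∧ isU x)
containsDU-∷ʳ []          x = refl
containsDU-∷ʳ (_ ∷ [])    x = Bool.∨-identityʳ _
containsDU-∷ʳ (y ∷ z ∷ w) x = trans (cong ((isD y ∧ isU z) ∨_) (containsDU-∷ʳ (z ∷ w) x)) (sym (Bool.∨-assoc (isD y ∧ isU z) _ _))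

allB-map : ∀ {A B : Set} (p : B → Bool) (f : A → B) xs → allB p (map f xs) ≡ allB (p ∘ f) xs
allB-map p f []       = refl
allB-map p f (x ∷ xs) = cong (p (f x) ∧_) (allB-map p f xs)

allB-inits-∷ʳ : ∀ (p : List Step → Bool) w x → allB p (inits (w ∷ʳ x)) ≡ allB p (inits w) ∧ p (w ∷ʳ x)
allB-inits-∷ʳ p []      x = trans (cong (p [] ∧_) (Bool.∧-identityʳ (p (x ∷ [])))) (sym (Bool.∧-assoc (p []) true (p (x ∷ []))))
allB-inits-∷ʳ p (y ∷ w) x = begin
  p [] ∧ allB p (map (y ∷_) (inits (w ∷ʳ x)))              ≡⟨ cong (p [] ∧_) (allB-map p (y ∷_) (inits (w ∷ʳ x))) ⟩
  p [] ∧ allB (p ∘ (y ∷_)) (inits (w ∷ʳ x))                ≡⟨ cong (p [] ∧_) (allB-inits-∷ʳ (p ∘ (y ∷_)) w x) ⟩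
  p [] ∧ (allB (p ∘ (y ∷_)) (inits w) ∧ p (y ∷ w ∷ʳ x))    ≡⟨ cong (λ b → p [] ∧ (b ∧ p (y ∷ w ∷ʳ x))) (allB-map p (y ∷_) (inits w)) ⟨
  p [] ∧ (allB p (map (y ∷_) (inits w)) ∧ p (y ∷ w ∷ʳ x))  ≡⟨ Bool.∧-assoc (p []) _ _ ⟨
  (p [] ∧ allB p (map (y ∷_) (inits w))) ∧ p (y ∷ w ∷ʳ x)  ∎
  where open ≡-Reasoning

allB-inits⇒self : ∀ (p : List Step → Bool) w → allB p (inits w) ≡ true → p w ≡ true
allB-inits⇒self p w all≡true with p [] in p[]
allB-inits⇒self p w       ()       | false
allB-inits⇒self p []      _        | true = p[]
allB-inits⇒self p (y ∷ w) all≡true | true =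
  allB-inits⇒self (p ∘ (y ∷_)) w (trans (sym (allB-map p (y ∷_) (inits w))) all≡true)

isMeander-∷ʳ : ∀ w x → isMeander (w ∷ʳ x) ≡ isMeander w ∧ (+ 0 ≤ᵇ level w ℤ.+ stepHeight x)
isMeander-∷ʳ w x = trans (allB-inits-∷ʳ (λ p → + 0 ≤ᵇ level p) w x) (cong (λ v → isMeander w ∧ (+ 0 ≤ᵇ v)) (level-∷ʳ w x))

canExtend : ℤ → Bool → Step → Bool
canExtend v e x = (+ 0 ≤ᵇ v ℤ.+ stepHeight x) ∧ (not (e ∧ isD x) ∧ not (e ∧ isU x))

inM-∷ʳ : ∀ w x → inM (w ∷ʳ x) ≡ inM w ∧ canExtend (level w) (endsWithD w) x
inM-∷ʳ w x = begin
  inM (w ∷ʳ x)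
    ≡⟨ cong₂ (λ m a → m ∧ a) (isMeander-∷ʳ w x) (cong₂ (λ a b → not a ∧ not b) (containsDD-∷ʳ w x) (containsDU-∷ʳ w x)) ⟩
  (m ∧ q) ∧ (not (dd ∨ ed) ∧ not (du ∨ eu))
    ≡⟨ cong₂ (λ a b → (m ∧ q) ∧ (a ∧ b)) (deMorgan₂ dd ed) (deMorgan₂ du eu) ⟩
  (m ∧ q) ∧ ((not dd ∧ not ed) ∧ (not du ∧ not eu))
    ≡⟨ solve 6 (λ m q a b c d → (m & q) & ((a & b) & (c & d)) ⊜ (m & (a & c)) & (q & (b & d))) refl m q (not dd) (not ed) (not du) (not eu) ⟩
  (m ∧ (not dd ∧ not du)) ∧ (q ∧ (not ed ∧ not eu))  ∎
  where
  open ≡-Reasoning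
  open import Algebra.Solver.CommutativeMonoid Bool.∧-commutativeMonoid using (solve; _⊜_) renaming (_⊕_ to _&_)
  open import Algebra.Lattice.Properties.BooleanAlgebra Bool.∨-∧-booleanAlgebra using (deMorgan₂)
  m q dd du ed eu : Bool
  m = isMeander w
  q = + 0 ≤ᵇ level w ℤ.+ stepHeight x
  dd = containsDD w
  du = containsDU w
  ed = endsWithD w ∧ isD x
  eu = endsWithD w ∧ isU x

inM⇒nonnegative : ∀ w → inM w ≡ true → (+ 0 ≤ᵇ level w) ≡ true
inM⇒nonnegative w member with isMeander w in meander
... | true = allB-inits⇒self (λ p → + 0 ≤ᵇ level p) w meander

data State : Set where
  dead : State
  live : (height : ℕ) (afterD : Bool) → State

next : State → Step → State
next dead                 _ = dead
next (live h _)           H = live h false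
next (live h true)        _ = dead
next (live h false)       U = live (suc h) false
next (live zero false)    D = dead
next (live (suc h) false) D = live h true

state : List Step → State
state w = if inM w then live ℤ.∣ level w ∣ (endsWithD w) else dead

canExtend-next : ∀ h e x → (if canExtend (+ h) e x then live ℤ.∣ + h ℤ.+ stepHeight x ∣ (isD x) else dead) ≡ next (live h e) x
canExtend-next h       true  H = cong (λ k → live k false) (ℕ.+-identityʳ h)
canExtend-next h       false H = cong (λ k → live k false) (ℕ.+-identityʳ h)
canExtend-next h       true  U = refl
canExtend-next h       false U = cong (λ k → live k false) (ℕ.+-comm h 1)
canExtend-next zero    true  D = refl
canExtend-next zero    false D = refl
canExtend-next (suc h) true  D = refl
canExtend-next (suc h) false D = refl

state-∷ʳ : ∀ w x → state (w ∷ʳ x) ≡ next (state w) x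
state-∷ʳ w x rewrite inM-∷ʳ w x | level-∷ʳ w x | endsWithD-∷ʳ w x with inM w in member
... | false = refl
... | true with level w | inM⇒nonnegative w member
...   | + h | _ = canExtend-next h (endsWithD w) x

isLive : ℕ → Bool → State → Bool
isLive h e dead        = false
isLive h e (live k e′) = does (e′ Bool.≟ e) ∧ does (k ℕ.≟ h)

countLive : ℕ → ℕ → Bool → ℕ
countLive n h e = sumWords n (λ w → indicator (isLive h e (state w)))

transfer : ℕ → Bool → State → ℕ
transfer h e s = indicator (isLive h e (next s U)) + indicator (isLive h e (next s H)) + indicator (isLive h e (next s D))

countLive-suc : ∀ n h e → countLive (suc n) h e ≡ sumWords n (λ w → transfer h e (state w))
countLive-suc n h e = begin
  countLive (suc n) h e
    ≡⟨ sumWords-∷ʳ n (counted ∘ state) ⟩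
  sumWords n (counted ∘ state ∘ (_∷ʳ U)) + sumWords n (counted ∘ state ∘ (_∷ʳ H)) + sumWords n (counted ∘ state ∘ (_∷ʳ D))
    ≡⟨ cong₂ _+_ (cong₂ _+_ (by-next U) (by-next H)) (by-next D) ⟩
  sumWords n (after U) + sumWords n (after H) + sumWords n (after D)
    ≡⟨ cong (_+ sumWords n (after D)) (sumWords-+ n (after U) (after H)) ⟨
  sumWords n (λ w → after U w + after H w) + sumWords n (after D)
    ≡⟨ sumWords-+ n (λ w → after U w + after H w) (after D) ⟨
  sumWords n (λ w → transfer h e (state w))  ∎
  where
  open ≡-Reasoning
  counted : State → ℕ
  counted s = indicator (isLive h e s)
  after : Step → List Step → ℕ
  after x w = counted (next (state w) x)
  by-next : ∀ x → sumWords n (counted ∘ state ∘ (_∷ʳ x)) ≡ sumWords n (after x)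
  by-next x = sumWords-cong n (λ w → cong counted (state-∷ʳ w x))

transfer-ground : ∀ s → transfer 0 false s ≡ indicator (isLive 0 false s) + indicator (isLive 0 true s)
transfer-ground dead                 = refl
transfer-ground (live zero    false) = refl
transfer-ground (live (suc k) false) = refl
transfer-ground (live zero    true)  = refl
transfer-ground (live (suc k) true)  = refl

transfer-raised : ∀ h s → transfer (suc h) false s ≡ indicator (isLive h false s) + indicator (isLive (suc h) false s) + indicator (isLive (suc h) true s)
transfer-raised h dead                 = refl
transfer-raised h (live zero    false) = refl
transfer-raised h (live (suc k) false) = refl
transfer-raised h (live zero    true)  = refl
transfer-raised h (live (suc k) true)  = ℕ.+-identityʳ _

transfer-afterD : ∀ h s → transfer h true s ≡ indicator (isLive (suc h) false s)
transfer-afterD h dead                 = refl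
transfer-afterD h (live zero    false) = refl
transfer-afterD h (live (suc k) false) = refl
transfer-afterD h (live k       true)  = refl

countLive-ground : ∀ n → countLive (suc n) 0 false ≡ countLive n 0 false + countLive n 0 true
countLive-ground n = trans (countLive-suc n 0 false) (trans (sumWords-cong n (transfer-ground ∘ state)) (sumWords-+ n _ _))

countLive-raised : ∀ n h → countLive (suc n) (suc h) false ≡ countLive n h false + countLive n (suc h) false + countLive n (suc h) true
countLive-raised n h = begin
  countLive (suc n) (suc h) false
    ≡⟨ countLive-suc n (suc h) false ⟩
  sumWords n (λ w → transfer (suc h) false (state w))
    ≡⟨ sumWords-cong n (transfer-raised h ∘ state) ⟩
  sumWords n (λ w → counted h false w + counted (suc h) false w + counted (suc h) true w)
    ≡⟨ sumWords-+ n _ _ ⟩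
  sumWords n (λ w → counted h false w + counted (suc h) false w) + countLive n (suc h) true
    ≡⟨ cong (_+ countLive n (suc h) true) (sumWords-+ n _ _) ⟩
  countLive n h false + countLive n (suc h) false + countLive n (suc h) true  ∎
  where
  open ≡-Reasoning
  counted : ℕ → Bool → List Step → ℕ
  counted h e w = indicator (isLive h e (state w))

countLive-afterD : ∀ n h → countLive (suc n) h true ≡ countLive n (suc h) false
countLive-afterD n h = trans (countLive-suc n h true) (sumWords-cong n (transfer-afterD h ∘ state))

countM-split : ∀ n j → countM n j ≡ countLive n j false + countLive n j true
countM-split n j = begin
  countM n j                                               ≡⟨ length-filterᵇ inMAt (allWords n) ⟩
  sum (map (indicator ∘ inMAt) (allWords n))               ≡⟨ sum-map-allWords n (indicator ∘ inMAt) ⟩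
  sumWords n (indicator ∘ inMAt)                           ≡⟨ sumWords-cong n split ⟩
  sumWords n (λ w → counted false w + counted true w)      ≡⟨ sumWords-+ n _ _ ⟩
  countLive n j false + countLive n j true                 ∎
  where
  open ≡-Reasoning
  inMAt : List Step → Bool
  inMAt w = inM w ∧ does (level w ℤ.≟ + j)
  counted : Bool → List Step → ℕ
  counted e w = indicator (isLive j e (state w))
  split : ∀ w → indicator (inMAt w) ≡ counted false w + counted true w
  split w with inM w in member
  ... | false = refl
  ... | true with level w | inM⇒nonnegative w member | endsWithD w
  ...   | + k | _ | false = sym (ℕ.+-identityʳ _)
  ...   | + k | _ | true  = refl

sumℚ-listSum : ListSum ℚ.+-*-commutativeRing
sumℚ-listSum = record { ∑ = sumℚ ; ∑-[] = refl ; ∑-∷ = λ _ _ → refl }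

module Univariate = CauchyProduct ℚ.+-*-commutativeRing sumℚ-listSum

seriesRing : CommutativeRing 0ℓ 0ℓ
seriesRing = Univariate.commutativeRing

open CommutativeRing seriesRing using (setoid; +-group)
  renaming (refl to ≈-refl; sym to ≈-sym; trans to ≈-trans; +-cong to ⊕-cong; *-cong to ⊛-cong; +-congˡ to ⊕-congˡ; +-congʳ to ⊕-congʳ; *-congˡ to ⊛-congˡ; *-congʳ to ⊛-congʳ)
module ≈-Reasoning = SetoidReasoning setoid
open GroupProperties +-group using (∙-cancelˡ; ∙-cancelʳ)

⊖-cong : ∀ {f f′ g g′} → f ≈ f′ → g ≈ g′ → f ⊖ g ≈ f′ ⊖ g′
⊖-cong f≈f′ g≈g′ n = cong₂ ℚ._-_ (f≈f′ n) (g≈g′ n)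

zS≈X : zS ≈ Univariate.X
zS≈X zero          = refl
zS≈X (suc zero)    = refl
zS≈X (suc (suc n)) = refl

zS-⊛≈X-⊛ : ∀ f → zS ⊛ f ≈ Univariate.X ⊛ f
zS-⊛≈X-⊛ f = Univariate.·-cong {g = f} zS≈X (λ _ → refl)

zS-⊛-zero : ∀ f → (zS ⊛ f) 0 ≡ 0ℚ
zS-⊛-zero f = ≡.trans (zS-⊛≈X-⊛ f 0) (Univariate.X-·-zero f)

zS-⊛-suc : ∀ f n → (zS ⊛ f) (suc n) ≡ f n
zS-⊛-suc f n = ≡.trans (zS-⊛≈X-⊛ f (suc n)) (Univariate.X-·-suc f n)

zS-⊛-causal : ∀ n {f g} → (∀ m → m < n → f m ≡ g m) → (zS ⊛ f) n ≡ (zS ⊛ g) n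
zS-⊛-causal n {f} {g} f≡g = ≡.trans (zS-⊛≈X-⊛ f n) (≡.trans (Univariate.X-·-causal n f≡g) (≡.sym (zS-⊛≈X-⊛ g n)))

zS-⊛-injective : ∀ {f g} → zS ⊛ f ≈ zS ⊛ g → f ≈ g
zS-⊛-injective {f} {g} eq n = ≡.trans (≡.sym (zS-⊛-suc f n)) (≡.trans (eq (suc n)) (zS-⊛-suc g n))

const≈ι : ∀ c → const c ≈ Univariate.ι c
const≈ι c zero    = refl
const≈ι c (suc n) = refl

scale≈const-⊛ : ∀ c f → scale c f ≈ const c ⊛ f
scale≈const-⊛ c f n = ≡.sym (≡.trans (Univariate.·-cong {g = f} (const≈ι c) (λ _ → refl) n) (Univariate.ι-· c f n))

scale-injective : ∀ {c d f g} → d ℚ.* c ≡ 1ℚ → scale c f ≈ scale c g → f ≈ g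
scale-injective {c} {d} {f} {g} d*c≡1 eq n = begin
  f n                  ≡⟨ ℚ.*-identityˡ (f n) ⟨
  1ℚ ℚ.* f n           ≡⟨ cong (ℚ._* f n) d*c≡1 ⟨
  d ℚ.* c ℚ.* f n      ≡⟨ ℚ.*-assoc d c (f n) ⟩
  d ℚ.* (c ℚ.* f n)    ≡⟨ cong (d ℚ.*_) (eq n) ⟩
  d ℚ.* (c ℚ.* g n)    ≡⟨ ℚ.*-assoc d c (g n) ⟨
  d ℚ.* c ℚ.* g n      ≡⟨ cong (ℚ._* g n) d*c≡1 ⟩
  1ℚ ℚ.* g n           ≡⟨ ℚ.*-identityˡ (g n) ⟩
  g n                  ∎
  where open ≡.≡-Reasoning

constMorphism : ℚ.+-*-rawRing -Raw-AlmostCommutative⟶ fromCommutativeRing seriesRing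
constMorphism = record
  { ⟦_⟧    = const
  ; +-homo = λ { a b zero → refl ; a b (suc n) → refl }
  ; *-homo = λ a b → ≈-trans (*-homo-scale a b) (scale≈const-⊛ a (const b))
  ; -‿homo = λ { a zero → refl ; a (suc n) → refl }
  ; 0-homo = λ { zero → refl ; (suc n) → refl }
  ; 1-homo = const≈ι 1ℚ
  }
  where
  *-homo-scale : ∀ a b → const (a ℚ.* b) ≈ scale a (const b)
  *-homo-scale a b zero    = refl
  *-homo-scale a b (suc n) = ≡.sym (ℚ.*-zeroʳ a)

const-≟ : ∀ a b → Maybe (const a ≈ const b)
const-≟ a b with a ℚ.≟ b
... | yes refl = just ≈-refl
... | no _     = nothing

module SeriesSolver = RingSolver ℚ.+-*-rawRing (fromCommutativeRing seriesRing) constMorphism const-≟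

open SeriesSolver using (solve; _:=_; _:+_; _:*_; _:-_; con)

zS^^-⊛-injective : ∀ k {f g} → (zS ^^ k) ⊛ f ≈ (zS ^^ k) ⊛ g → f ≈ g
zS^^-⊛-injective zero    {f} {g} eq = begin
  f       ≈⟨ solve 1 (λ f → f := con 1ℚ :* f) ≈-refl f ⟩
  𝟙 ⊛ f   ≈⟨ eq ⟩
  𝟙 ⊛ g   ≈⟨ solve 1 (λ g → con 1ℚ :* g := g) ≈-refl g ⟩
  g       ∎
  where open ≈-Reasoning
zS^^-⊛-injective (suc k) {f} {g} eq = zS^^-⊛-injective k (zS-⊛-injective (begin
  zS ⊛ ((zS ^^ k) ⊛ f)   ≈⟨ solve 3 (λ z q f → z :* (q :* f) := (z :* q) :* f) ≈-refl zS (zS ^^ k) f ⟩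
  (zS ^^ suc k) ⊛ f      ≈⟨ eq ⟩
  (zS ^^ suc k) ⊛ g      ≈⟨ solve 3 (λ z q g → (z :* q) :* g := z :* (q :* g)) ≈-refl zS (zS ^^ k) g ⟩
  zS ⊛ ((zS ^^ k) ⊛ g)   ∎))
  where open ≈-Reasoning

-- Rewriting ℕtoℚ n to its normal form mkℚ (+ n) 0 _ makes the sum on the right compute.
ℕtoℚ-suc : ∀ n → ℕtoℚ (suc n) ≡ 1ℚ ℚ.+ ℕtoℚ n
ℕtoℚ-suc n rewrite ℚ.normalize-coprime (Coprimality.sym (Coprimality.1-coprimeTo n)) =
  cong (λ k → k ℚ./ 1) (cong (ℤ._+_ (+ 1)) (≡.sym (ℤ.*-identityʳ (+ n))))

ℕtoℚ-+ : ∀ m n → ℕtoℚ (m + n) ≡ ℕtoℚ m ℚ.+ ℕtoℚ n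
ℕtoℚ-+ zero    n = ≡.sym (ℚ.+-identityˡ (ℕtoℚ n))
ℕtoℚ-+ (suc m) n = begin
  ℕtoℚ (suc (m + n))               ≡⟨ ℕtoℚ-suc (m + n) ⟩
  1ℚ ℚ.+ ℕtoℚ (m + n)              ≡⟨ cong (1ℚ ℚ.+_) (ℕtoℚ-+ m n) ⟩
  1ℚ ℚ.+ (ℕtoℚ m ℚ.+ ℕtoℚ n)         ≡⟨ ℚ.+-assoc 1ℚ (ℕtoℚ m) (ℕtoℚ n) ⟨
  1ℚ ℚ.+ ℕtoℚ m ℚ.+ ℕtoℚ n           ≡⟨ cong (ℚ._+ ℕtoℚ n) (ℕtoℚ-suc m) ⟨
  ℕtoℚ (suc m) ℚ.+ ℕtoℚ n            ∎
  where open ≡.≡-Reasoning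

-- The generating functions A_h and B_h

A B : ℕ → Series
A h n = ℕtoℚ (countLive n h false)
B h n = ℕtoℚ (countLive n h true)

zS-⊛-from-tail : ∀ {f g} → f 0 ≡ 0ℚ → (∀ n → f (suc n) ≡ g n) → f ≈ zS ⊛ g
zS-⊛-from-tail {g = g} head tail zero    = ≡.trans head (≡.sym (zS-⊛-zero g))
zS-⊛-from-tail {g = g} head tail (suc n) = ≡.trans (tail n) (≡.sym (zS-⊛-suc g n))

const⊕zS-⊛-from-tail : ∀ {f g} → (∀ n → f (suc n) ≡ g n) → f ≈ const (f 0) ⊕ zS ⊛ g
const⊕zS-⊛-from-tail {f} {g} tail zero    = ≡.sym (≡.trans (cong (f 0 ℚ.+_) (zS-⊛-zero g)) (ℚ.+-identityʳ (f 0)))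
const⊕zS-⊛-from-tail {f} {g} tail (suc n) = ≡.trans (tail n) (≡.sym (≡.trans (ℚ.+-identityˡ _) (zS-⊛-suc g n)))

Fj≈A⊕B : ∀ j → Fj j ≈ A j ⊕ B j
Fj≈A⊕B j n = ≡.trans (cong ℕtoℚ (countM-split n j)) (ℕtoℚ-+ (countLive n j false) (countLive n j true))

A₀-equation : A 0 ≈ 𝟙 ⊕ zS ⊛ (A 0 ⊕ B 0)
A₀-equation = const⊕zS-⊛-from-tail λ n →
  ≡.trans (cong ℕtoℚ (countLive-ground n)) (ℕtoℚ-+ (countLive n 0 false) (countLive n 0 true))

A-equation : ∀ h → A (suc h) ≈ zS ⊛ (A h ⊕ A (suc h) ⊕ B (suc h))
A-equation h = zS-⊛-from-tail refl λ n → begin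
  ℕtoℚ (countLive (suc n) (suc h) false)                       ≡⟨ cong ℕtoℚ (countLive-raised n h) ⟩
  ℕtoℚ (countLive n h false + countLive n (suc h) false + countLive n (suc h) true)
                                                               ≡⟨ ℕtoℚ-+ (countLive n h false + countLive n (suc h) false) _ ⟩
  ℕtoℚ (countLive n h false + countLive n (suc h) false) ℚ.+ B (suc h) n
                                                               ≡⟨ cong (ℚ._+ B (suc h) n) (ℕtoℚ-+ (countLive n h false) _) ⟩
  A h n ℚ.+ A (suc h) n ℚ.+ B (suc h) n                        ∎
  where open ≡.≡-Reasoning

B-equation : ∀ h → B h ≈ zS ⊛ A (suc h)
B-equation h = zS-⊛-from-tail refl λ n → cong ℕtoℚ (countLive-afterD n h)

module SeriesFamilies (I : Set) = CausalFixedPoint (≡.setoid ℚ) I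

levelSystem : (ℕ → Series) → ℕ → Series
levelSystem x zero    = zS ⊛ (zS ⊕ x 0 ⊕ x 1)
levelSystem x (suc h) = zS ⊛ (zS ⊛ x h ⊕ x (suc h) ⊕ x (suc (suc h)))

open SeriesFamilies ℕ using () renaming (Causal to CausalOnLevels; IsFixedPoint to IsLevelFixedPoint)

levelSystem-causal : CausalOnLevels levelSystem
levelSystem-causal n agree zero    = zS-⊛-causal n λ m m<n →
  cong₂ ℚ._+_ (cong ((zS m) ℚ.+_) (agree 0 m m<n)) (agree 1 m m<n)
levelSystem-causal n agree (suc h) = zS-⊛-causal n λ m m<n →
  cong₂ ℚ._+_ (cong₂ ℚ._+_ (zS-⊛-causal m λ k k<m → agree h k (ℕ.<-trans k<m m<n)) (agree (suc h) m m<n))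
              (agree (suc (suc h)) m m<n)

kernelMap : Series → Series
kernelMap r = zS ⊛ (zS ⊕ r ⊕ r ⊛ r)

zPowerA : ℕ → Series
zPowerA h = (zS ^^ suc (suc h)) ⊛ A h

zPowerA-fixed : IsLevelFixedPoint levelSystem zPowerA
zPowerA-fixed zero = begin
  (zS ^^ 2) ⊛ A 0
    ≈⟨ ⊛-congˡ {zS ^^ 2} (≈-trans A₀-equation (⊕-congˡ {𝟙} (⊛-congˡ {zS} (⊕-congˡ {A 0} (B-equation 0))))) ⟩
  (zS ^^ 2) ⊛ (𝟙 ⊕ zS ⊛ (A 0 ⊕ zS ⊛ A 1))
    ≈⟨ solve 3 (λ z a₀ a₁ → (z :* (z :* con 1ℚ)) :* (con 1ℚ :+ z :* (a₀ :+ z :* a₁))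
                         := z :* (z :+ (z :* (z :* con 1ℚ)) :* a₀ :+ (z :* (z :* (z :* con 1ℚ))) :* a₁))
               ≈-refl zS (A 0) (A 1) ⟩
  levelSystem zPowerA 0 ∎
  where open ≈-Reasoning
zPowerA-fixed (suc h) = begin
  (zS ^^ suc (suc (suc h))) ⊛ A (suc h)
    ≈⟨ ⊛-congˡ {zS ^^ suc (suc (suc h))} (≈-trans (A-equation h) (⊛-congˡ {zS} (⊕-congˡ {A h ⊕ A (suc h)} (B-equation (suc h))))) ⟩
  (zS ^^ suc (suc (suc h))) ⊛ (zS ⊛ (A h ⊕ A (suc h) ⊕ zS ⊛ A (suc (suc h))))
    ≈⟨ solve 5 (λ z q a₀ a₁ a₂ → (z :* (z :* q)) :* (z :* (a₀ :+ a₁ :+ z :* a₂))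
                             := z :* (z :* ((z :* q) :* a₀) :+ (z :* (z :* q)) :* a₁ :+ (z :* (z :* (z :* q))) :* a₂))
               ≈-refl zS (zS ^^ suc h) (A h) (A (suc h)) (A (suc (suc h))) ⟩
  levelSystem zPowerA (suc h) ∎
  where open ≈-Reasoning

powers-fixed : ∀ r → r ≈ kernelMap r → IsLevelFixedPoint levelSystem (λ h → r ^^ suc h)
powers-fixed r r-root zero = begin
  r ⊛ 𝟙                              ≈⟨ solve 1 (λ r → r :* con 1ℚ := r) ≈-refl r ⟩
  r                                  ≈⟨ r-root ⟩
  zS ⊛ (zS ⊕ r ⊕ r ⊛ r)              ≈⟨ solve 2 (λ z r → z :* (z :+ r :+ r :* r) := z :* (z :+ r :* con 1ℚ :+ r :* (r :* con 1ℚ))) ≈-refl zS r ⟩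
  zS ⊛ (zS ⊕ r ^^ 1 ⊕ r ^^ 2)        ∎
  where open ≈-Reasoning
powers-fixed r r-root (suc h) = begin
  r ⊛ (r ^^ suc h)                   ≈⟨ ⊛-congʳ {r ^^ suc h} r-root ⟩
  kernelMap r ⊛ (r ^^ suc h)         ≈⟨ solve 3 (λ z r q → z :* (z :+ r :+ r :* r) :* (r :* q) := z :* (z :* (r :* q) :+ r :* (r :* q) :+ r :* (r :* (r :* q))))
                                          ≈-refl zS r (r ^^ h) ⟩
  levelSystem (λ h → r ^^ suc h) (suc h) ∎
  where open ≈-Reasoning

zPowerA≈powers : ∀ r → r ≈ kernelMap r → ∀ h → zPowerA h ≈ r ^^ suc h
zPowerA≈powers r r-root = SeriesFamilies.fixedPoint-unique ℕ levelSystem-causal zPowerA-fixed (powers-fixed r r-root)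

Fj-identity : ∀ r → r ≈ kernelMap r → ∀ j → (zS ^^ suc (suc j)) ⊛ Fj j ≈ (𝟙 ⊕ r) ⊛ (r ^^ suc j)
Fj-identity r r-root j = begin
  (zS ^^ suc (suc j)) ⊛ Fj j
    ≈⟨ ⊛-congˡ {zS ^^ suc (suc j)} (≈-trans (Fj≈A⊕B j) (⊕-congˡ {A j} (B-equation j))) ⟩
  (zS ^^ suc (suc j)) ⊛ (A j ⊕ zS ⊛ A (suc j))
    ≈⟨ solve 4 (λ z q a₀ a₁ → (z :* (z :* q)) :* (a₀ :+ z :* a₁) := (z :* (z :* q)) :* a₀ :+ (z :* (z :* (z :* q))) :* a₁)
               ≈-refl zS (zS ^^ j) (A j) (A (suc j)) ⟩
  zPowerA j ⊕ zPowerA (suc j)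
    ≈⟨ ⊕-cong (zPowerA≈powers r r-root j) (zPowerA≈powers r r-root (suc j)) ⟩
  r ^^ suc j ⊕ r ^^ suc (suc j)
    ≈⟨ solve 2 (λ r q → r :* q :+ r :* (r :* q) := (con 1ℚ :+ r) :* (r :* q)) ≈-refl r (r ^^ j) ⟩
  (𝟙 ⊕ r) ⊛ (r ^^ suc j)  ∎
  where open ≈-Reasoning

-- The kernel root r₁ and the square root W

kernelMap-causal : SeriesFamilies.Causal ⊤ (λ x _ → kernelMap (x tt))
kernelMap-causal n agree _ = zS-⊛-causal n λ m m<n →
  let agree≤m = λ k k≤m → agree tt k (ℕ.≤-<-trans k≤m m<n) in
  cong₂ ℚ._+_ (cong (zS m ℚ.+_) (agree tt m m<n)) (Univariate.·-local m agree≤m agree≤m)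

kernelRoot : Series
kernelRoot = SeriesFamilies.fixedPoint ⊤ kernelMap-causal (λ _ → 𝟘) tt

kernelRoot-fixed : kernelRoot ≈ kernelMap kernelRoot
kernelRoot-fixed = SeriesFamilies.fixedPoint-isFixedPoint ⊤ kernelMap-causal (λ _ → 𝟘) tt

rootToW : Series → Series
rootToW r = 𝟙 ⊖ zS ⊖ const (ℕtoℚ 2) ⊛ zS ⊛ r

rootToW-zero : ∀ r → rootToW r 0 ≡ 1ℚ
rootToW-zero r = cong (λ c → 1ℚ ℚ.- 0ℚ ℚ.- c) (≡.trans (Univariate.·-zero (const (ℕtoℚ 2) ⊛ zS) r) (ℚ.*-zeroˡ (r 0)))

-- Wsq − (1 − z − 2zr)² = 4z (r − kernelMap r), without subtraction so it cancels either way.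
Wsq-identity : ∀ r → rootToW r ⊛ rootToW r ⊕ const (ℕtoℚ 4) ⊛ (zS ⊛ r) ≈ Wsq ⊕ const (ℕtoℚ 4) ⊛ (zS ⊛ kernelMap r)
Wsq-identity r = begin
  rootToW r ⊛ rootToW r ⊕ c4 ⊛ (zS ⊛ r)
    ≈⟨ solve 2 (λ z r → (con 1ℚ :- z :- con (ℕtoℚ 2) :* z :* r) :* (con 1ℚ :- z :- con (ℕtoℚ 2) :* z :* r) :+ con (ℕtoℚ 4) :* (z :* r)
                     := con 1ℚ :- con (ℕtoℚ 2) :* z :+ z :* (z :* con 1ℚ) :- con (ℕtoℚ 4) :* (z :* (z :* (z :* con 1ℚ)))
                        :+ con (ℕtoℚ 4) :* (z :* (z :* (z :+ r :+ r :* r))))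
               ≈-refl zS r ⟩
  𝟙 ⊖ c2 ⊛ zS ⊕ zS ^^ 2 ⊖ c4 ⊛ (zS ^^ 3) ⊕ c4 ⊛ (zS ⊛ kernelMap r)
    ≈⟨ ⊕-congʳ {c4 ⊛ (zS ⊛ kernelMap r)} (⊖-cong (⊕-congʳ {zS ^^ 2} (⊖-cong (≈-refl {𝟙}) (scale≈const-⊛ (ℕtoℚ 2) zS)))
                                                 (scale≈const-⊛ (ℕtoℚ 4) (zS ^^ 3))) ⟨
  Wsq ⊕ c4 ⊛ (zS ⊛ kernelMap r)  ∎
  where
  open ≈-Reasoning
  c2 c4 : Series
  c2 = const (ℕtoℚ 2)
  c4 = const (ℕtoℚ 4)

rootToW-square : ∀ r → r ≈ kernelMap r → rootToW r ⊛ rootToW r ≈ Wsq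
rootToW-square r r-root = ∙-cancelʳ (const (ℕtoℚ 4) ⊛ (zS ⊛ r)) _ _ (begin
  rootToW r ⊛ rootToW r ⊕ const (ℕtoℚ 4) ⊛ (zS ⊛ r)     ≈⟨ Wsq-identity r ⟩
  Wsq ⊕ const (ℕtoℚ 4) ⊛ (zS ⊛ kernelMap r)             ≈⟨ ⊕-congˡ {Wsq} (⊛-congˡ {const (ℕtoℚ 4)} (⊛-congˡ {zS} r-root)) ⟨
  Wsq ⊕ const (ℕtoℚ 4) ⊛ (zS ⊛ r)                       ∎)
  where open ≈-Reasoning

kernelMap-root : ∀ W r → W ⊛ W ≈ Wsq → W ≈ rootToW r → r ≈ kernelMap r
kernelMap-root W r W² W≈ = zS-⊛-injective (scale-injective {d = + 1 ℚ./ 4} refl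
  (≈-trans (scale≈const-⊛ (ℕtoℚ 4) (zS ⊛ r)) (≈-trans cancelled (≈-sym (scale≈const-⊛ (ℕtoℚ 4) (zS ⊛ kernelMap r))))))
  where
  open ≈-Reasoning
  cancelled : const (ℕtoℚ 4) ⊛ (zS ⊛ r) ≈ const (ℕtoℚ 4) ⊛ (zS ⊛ kernelMap r)
  cancelled = ∙-cancelˡ Wsq _ _ (begin
    Wsq ⊕ const (ℕtoℚ 4) ⊛ (zS ⊛ r)                       ≈⟨ ⊕-congʳ {const (ℕtoℚ 4) ⊛ (zS ⊛ r)} (≈-trans (≈-sym W²) (⊛-cong W≈ W≈)) ⟩
    rootToW r ⊛ rootToW r ⊕ const (ℕtoℚ 4) ⊛ (zS ⊛ r)     ≈⟨ Wsq-identity r ⟩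
    Wsq ⊕ const (ℕtoℚ 4) ⊛ (zS ⊛ kernelMap r)             ∎)

W≈rootToW : ∀ W r → scale (ℕtoℚ 2) zS ⊛ r ≈ 𝟙 ⊖ zS ⊖ W → W ≈ rootToW r
W≈rootToW W r hyp = begin
  W                                  ≈⟨ solve 2 (λ z w → w := con 1ℚ :- z :- (con 1ℚ :- z :- w)) ≈-refl zS W ⟩
  𝟙 ⊖ zS ⊖ (𝟙 ⊖ zS ⊖ W)              ≈⟨ ⊖-cong (≈-refl {𝟙 ⊖ zS}) (≈-sym hyp) ⟩
  𝟙 ⊖ zS ⊖ scale (ℕtoℚ 2) zS ⊛ r     ≈⟨ ⊖-cong (≈-refl {𝟙 ⊖ zS}) (⊛-congʳ {r} (scale≈const-⊛ (ℕtoℚ 2) zS)) ⟩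
  rootToW r                          ∎
  where open ≈-Reasoning

-- The bivariate series S(u)

𝟘≈𝟎 : 𝟘 ≈ Univariate.𝟎
𝟘≈𝟎 zero    = refl
𝟘≈𝟎 (suc n) = refl

sumS-listSum : ListSum seriesRing
sumS-listSum = record { ∑ = sumS ; ∑-[] = 𝟘≈𝟎 ; ∑-∷ = λ _ _ → ≈-refl }

module Bivariate = CauchyProduct seriesRing sumS-listSum

bivariateRing : CommutativeRing 0ℓ 0ℓ
bivariateRing = Bivariate.commutativeRing

embed≈ι : ∀ f → embed f ≈₂ Bivariate.ι f
embed≈ι f zero    = ≈-refl
embed≈ι f (suc j) = 𝟘≈𝟎

uB≈X : uB ≈₂ Bivariate.X
uB≈X zero          = 𝟘≈𝟎
uB≈X (suc zero)    = const≈ι 1ℚ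
uB≈X (suc (suc j)) = 𝟘≈𝟎

embed-⊛₂ : ∀ f G j → (embed f ⊛₂ G) j ≈ f ⊛ G j
embed-⊛₂ f G j = ≈-trans (Bivariate.·-cong {g = G} (embed≈ι f) (λ _ → ≈-refl) j) (Bivariate.ι-· f G j)

uB-⊛₂-zero : ∀ G → (uB ⊛₂ G) 0 ≈ Univariate.𝟎
uB-⊛₂-zero G = ≈-trans (Bivariate.·-cong {g = G} uB≈X (λ _ → ≈-refl) 0) (Bivariate.X-·-zero G)

uB-⊛₂-suc : ∀ G j → (uB ⊛₂ G) (suc j) ≈ G j
uB-⊛₂-suc G j = ≈-trans (Bivariate.·-cong {g = G} uB≈X (λ _ → ≈-refl) (suc j)) (Bivariate.X-·-suc G j)

kernelForm-⊛₂ : ∀ r G j → (embed zS ⊛₂ (embed zS ⊖₂ uB ⊛₂ embed r) ⊛₂ G) j ≈ zS ⊛ (zS ⊛ G j ⊖ (uB ⊛₂ (embed r ⊛₂ G)) j)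
kernelForm-⊛₂ r G j = begin
  (embed zS ⊛₂ M ⊛₂ G) j
    ≈⟨ Bivariate.·-assoc (embed zS) M G j ⟩
  (embed zS ⊛₂ (M ⊛₂ G)) j
    ≈⟨ embed-⊛₂ zS (M ⊛₂ G) j ⟩
  zS ⊛ (M ⊛₂ G) j
    ≈⟨ ⊛-congˡ {zS} ([y-z]x≈yx-zx G (embed zS) (uB ⊛₂ embed r) j) ⟩
  zS ⊛ ((embed zS ⊛₂ G) j ⊖ ((uB ⊛₂ embed r) ⊛₂ G) j)
    ≈⟨ ⊛-congˡ {zS} (⊖-cong (embed-⊛₂ zS G j) (Bivariate.·-assoc uB (embed r) G j)) ⟩
  zS ⊛ (zS ⊛ G j ⊖ (uB ⊛₂ (embed r ⊛₂ G)) j)  ∎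
  where
  open ≈-Reasoning
  open import Algebra.Properties.Ring (CommutativeRing.ring bivariateRing) using ([y-z]x≈yx-zx)
  M : BSeries
  M = embed zS ⊖₂ uB ⊛₂ embed r

kernelEquation : ∀ r → r ≈ kernelMap r → embed zS ⊛₂ (embed zS ⊖₂ uB ⊛₂ embed r) ⊛₂ S ≈₂ embed (r ⊛ (𝟙 ⊕ r))
kernelEquation r r-root zero = begin
  (embed zS ⊛₂ (embed zS ⊖₂ uB ⊛₂ embed r) ⊛₂ S) 0
    ≈⟨ kernelForm-⊛₂ r S 0 ⟩
  zS ⊛ (zS ⊛ S 0 ⊖ (uB ⊛₂ (embed r ⊛₂ S)) 0)
    ≈⟨ ⊛-congˡ {zS} (⊖-cong (≈-refl {zS ⊛ S 0}) (≈-trans (uB-⊛₂-zero (embed r ⊛₂ S)) (≈-sym 𝟘≈𝟎))) ⟩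
  zS ⊛ (zS ⊛ S 0 ⊖ 𝟘)
    ≈⟨ solve 2 (λ z s → z :* (z :* s :- con 0ℚ) := (z :* (z :* con 1ℚ)) :* s) ≈-refl zS (S 0) ⟩
  (zS ^^ 2) ⊛ Fj 0
    ≈⟨ Fj-identity r r-root 0 ⟩
  (𝟙 ⊕ r) ⊛ (r ^^ 1)
    ≈⟨ solve 1 (λ r → (con 1ℚ :+ r) :* (r :* con 1ℚ) := r :* (con 1ℚ :+ r)) ≈-refl r ⟩
  r ⊛ (𝟙 ⊕ r)  ∎
  where open ≈-Reasoning
kernelEquation r r-root (suc j) = begin
  (embed zS ⊛₂ (embed zS ⊖₂ uB ⊛₂ embed r) ⊛₂ S) (suc j)
    ≈⟨ kernelForm-⊛₂ r S (suc j) ⟩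
  zS ⊛ (zS ⊛ S (suc j) ⊖ (uB ⊛₂ (embed r ⊛₂ S)) (suc j))
    ≈⟨ ⊛-congˡ {zS} (⊖-cong (≈-refl {zS ⊛ S (suc j)}) (≈-trans (uB-⊛₂-suc (embed r ⊛₂ S) j) (embed-⊛₂ r S j))) ⟩
  zS ⊛ (zS ⊛ S (suc j) ⊖ r ⊛ S j)
    ≈⟨ zS^^-⊛-injective (suc j) vanishes ⟩
  𝟘  ∎
  where
  open ≈-Reasoning
  vanishes : (zS ^^ suc j) ⊛ (zS ⊛ (zS ⊛ S (suc j) ⊖ r ⊛ S j)) ≈ (zS ^^ suc j) ⊛ 𝟘
  vanishes = begin
    (zS ^^ suc j) ⊛ (zS ⊛ (zS ⊛ S (suc j) ⊖ r ⊛ S j))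
      ≈⟨ solve 5 (λ z q s₁ s₀ r → (z :* q) :* (z :* (z :* s₁ :- r :* s₀)) := (z :* (z :* (z :* q))) :* s₁ :- r :* ((z :* (z :* q)) :* s₀))
                 ≈-refl zS (zS ^^ j) (S (suc j)) (S j) r ⟩
    (zS ^^ suc (suc (suc j))) ⊛ Fj (suc j) ⊖ r ⊛ ((zS ^^ suc (suc j)) ⊛ Fj j)
      ≈⟨ ⊖-cong (Fj-identity r r-root (suc j)) (⊛-congˡ {r} (Fj-identity r r-root j)) ⟩
    (𝟙 ⊕ r) ⊛ (r ^^ suc (suc j)) ⊖ r ⊛ ((𝟙 ⊕ r) ⊛ (r ^^ suc j))
      ≈⟨ solve 4 (λ z p r q → (con 1ℚ :+ r) :* (r :* (r :* q)) :- r :* ((con 1ℚ :+ r) :* (r :* q)) := (z :* p) :* con 0ℚ)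
                 ≈-refl zS (zS ^^ j) r (r ^^ j) ⟩
    (zS ^^ suc j) ⊛ 𝟘  ∎

mainTheorem3 : (Σ Series (λ W → (W 0 ≡ 1ℚ) × (W ⊛ W ≈ Wsq)))
    × ((W r₁ : Series) → W 0 ≡ 1ℚ → W ⊛ W ≈ Wsq
        → scale (ℕtoℚ 2) zS ⊛ r₁ ≈ 𝟙 ⊖ zS ⊖ W
        → (embed zS ⊛₂ (embed zS ⊖₂ uB ⊛₂ embed r₁) ⊛₂ S ≈₂ embed (r₁ ⊛ (𝟙 ⊕ r₁)))
          × ((j : ℕ) → (zS ^^ (suc (suc j))) ⊛ Fj j ≈ (𝟙 ⊕ r₁) ⊛ (r₁ ^^ (suc j))))
mainTheorem3 = (rootToW kernelRoot , rootToW-zero kernelRoot , rootToW-square kernelRoot kernelRoot-fixed)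
             , λ W r₁ _ W² 2zr₁≈1-z-W →
                 let r₁-root = kernelMap-root W r₁ W² (W≈rootToW W r₁ 2zr₁≈1-z-W)
                 in kernelEquation r₁ r₁-root , Fj-identity r₁ r₁-root
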